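{- Let $k\ge 2$, let $G$ be a graph with minimum degree at least $k$, and let $L=(P,C)$ be an optimal lollipop of $G$ with $C=c_1\dots c_tc_1$. Then every active path contains (as one of its edges) every passive edge of $C$.
   Context: All graphs are finite and simple. A path is a sequence $p_1\dots p_s$ of distinct vertices with consecutive vertices adjacent; a cycle is a sequence $c_1\dots c_t c_1$ ($t\ge 3$) of distinct vertices with consecutive vertices (indices mod $t$) adjacent; its length is its number of edges. A chord of a path/cycle is an edge of $G$ between two of its vertices that is not one of its edges. For a path $Q$ and vertices $a,b$ on $Q$, $aQb$ denotes the subpath of $Q$ from $a$ to $b$. A lollipop in $G$ is a pair $L=(P,C)$ where $P=p_1\dots p_s$ ($s\geq 1$) is a path, $C=c_1\dots c_tc_1$ ($t\geq 3$) is a cycle, $p_s=c_1$ and $V(P)\cap V(C)=\{c_1\}$; $V(L)=V(P)\cup V(C)$. $L=(P,C)$ is optimal if no lollipop $L'$ satisfies $V(L)\subsetneq V(L')$, and no lollipop $L'=(P',C')$ with $V(L')=V(L)$ has $C'$ longer than $C$. Sets $\mathcal S_i$ of Hamiltonian paths of $G[V(C)]$ starting at $c_1$: $\mathcal S_1=\{c_1c_2\dots c_t,\ c_1c_tc_{t-1}\dots c_2\}$; for $i\ge 1$, $\mathcal S_{i+1}$ is the set of all paths obtained as follows: for each $Q=c_1\dots u\in\mathcal S_i$ and each vertex $v$ such that $uv$ is a chord of $Q$, let $w$ be the neighbor of $v$ on $vQu$; if $vw$ is an edge of $C$, then $c_1QvuQw$ is put in $\mathcal S_{i+1}$. A path is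 active if it belongs to $\mathcal S_i$ for some $i\ge 1$. A vertex $u\neq c_1$ is active if it is the end (other than $c_1$) of an active path; $c_1$ is not active. An edge of $C$ is passive if neither of its ends is active. -}

module Defs where

open import Data.Nat using (ℕ; _≤_)
open import Data.Fin using (Fin)
open import Data.List using (List; []; _∷_; _++_; [_]; reverse; length)
open import Data.List.Membership.Propositional using (_∈_; _∉_)
open import Data.List.Relation.Unary.Unique.Propositional using (Unique)
open import Data.List.Relation.Unary.Linked using (Linked)
open import Data.List.Relation.Binary.Subset.Propositional using (_⊆_)
open import Data.Product using (Σ; ∃; _×_; _,_)
open import Data.Sum using (_⊎_)
open import Data.Empty using (⊥)
open import Relation.Nullary using (¬_)
open import Relation.Binary.PropositionalEquality using (_≡_; _≢_)
open import Function.Definitions using (Injective)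

record Graph : Set₁ where
  field
    n     : ℕ
    E     : Fin n → Fin n → Set
    sym   : ∀ {x y} → E x y → E y x
    irrefl : ∀ {x} → ¬ E x x

module _ (G : Graph) where
  open Graph G

  V : Set
  V = Fin n

  MinDegAtLeast : ℕ → Set
  MinDegAtLeast k = ∀ (v : V) →
    Σ (Fin k → V) λ f → Injective _≡_ _≡_ f × (∀ i → E v (f i))

  IsPath : List V → Set
  IsPath xs = Unique xs × Linked E xs

  -- the cycle c1 c2 ... ct c1, given as c1 and the list c2 ... ct (t ≥ 3)
  IsCycle : V → List V → Set
  IsCycle c1 cs = 2 ≤ length cs × Unique (c1 ∷ cs) × Linked E (c1 ∷ cs ++ [ c1 ])

  -- a lollipop (P, C): P = pre ++ [c1] (so s ≥ 1), C = c1 cs c1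
  record Lollipop : Set where
    field
      pre  : List V
      c1   : V
      cs   : List V
      path : IsPath (pre ++ [ c1 ])
      cyc  : IsCycle c1 cs
      disj : ∀ {x} → x ∈ pre → x ∉ (c1 ∷ cs)

  VL : Lollipop → List V
  VL L = Lollipop.pre L ++ Lollipop.c1 L ∷ Lollipop.cs L

  cycLen : Lollipop → ℕ
  cycLen L = length (Lollipop.c1 L ∷ Lollipop.cs L)

  Optimal : Lollipop → Set
  Optimal L =
    (∀ (L' : Lollipop) → ¬ (VL L ⊆ VL L' × Σ V λ x → x ∈ VL L' × x ∉ VL L))
    × (∀ (L' : Lollipop) → VL L ⊆ VL L' → VL L' ⊆ VL L → cycLen L' ≤ cycLen L)

Consec : {A : Set} → List A → A → A → Set
Consec {A} xs x y = Σ (List A) λ as → Σ (List A) λ bs → xs ≡ as ++ x ∷ y ∷ bs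

EdgeOf : {A : Set} → List A → A → A → Set
EdgeOf xs x y = Consec xs x y ⊎ Consec xs y x

module _ (G : Graph) where
  open Graph G

  CycleEdge : Fin n → List (Fin n) → Fin n → Fin n → Set
  CycleEdge c1 cs x y = EdgeOf (c1 ∷ cs ++ [ c1 ]) x y

  -- S c1 cs i Q  :  Q ∈ 𝒮_{i+1}  (index shifted: S 0 is the paper's 𝒮_1)
  -- The step: Q = A v w B u with uv ∈ E(G) (a chord, since w ≠ u), w the
  -- neighbour of v on vQu; if vw is an edge of C, then c1QvuQw = A v u (rev B) w.
  data S (c1 : Fin n) (cs : List (Fin n)) : ℕ → List (Fin n) → Set where
    base₁ : S c1 cs 0 (c1 ∷ cs)
    base₂ : S c1 cs 0 (c1 ∷ reverse cs)
    step  : ∀ {i} (as bs : List (Fin n)) (v w u : Fin n) →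
            S c1 cs i (as ++ v ∷ w ∷ bs ++ [ u ]) →
            E u v →
            CycleEdge c1 cs v w →
            S c1 cs (ℕ.suc i) (as ++ v ∷ u ∷ reverse bs ++ [ w ])

  ActivePath : Fin n → List (Fin n) → List (Fin n) → Set
  ActivePath c1 cs Q = Σ ℕ λ i → S c1 cs i Q

  Last : List (Fin n) → Fin n → Set
  Last Q u = Σ (List (Fin n)) λ as → Q ≡ as ++ [ u ]

  ActiveVertex : Fin n → List (Fin n) → Fin n → Set
  ActiveVertex c1 cs u = u ≢ c1 × Σ (List (Fin n)) λ Q → ActivePath c1 cs Q × Last Q u

  PassiveEdge : Fin n → List (Fin n) → Fin n → Fin n → Set
  PassiveEdge c1 cs x y = CycleEdge c1 cs x y × ¬ ActiveVertex c1 cs x × ¬ ActiveVertex c1 cs y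

-- An active path arises from c₁c₂…c_t or c₁c_t…c₂ by reroutings  A v w B u ↦ A v u B⁻¹ w,
-- each of which keeps every edge of the path except those at w, and w is active (it ends the
-- new path) and differs from c₁ (active paths never return to c₁).  So a passive edge, which
-- avoids all active vertices, survives every rerouting.  It is on both initial paths as well:
-- c₁c₂…c_t misses only c_tc₁, and c_t is active; c₁c_t…c₂ misses only c₁c₂, and c₂ is active.
module Submission where

open import Defs
open import Data.Nat using (ℕ; _≤_; suc)
open import Data.List using (List; []; _∷_; _++_; [_]; reverse)
open import Data.List.Properties using (unfold-reverse; reverse-++; ++-assoc; ∷-injectiveʳ)
open import Data.List.Membership.Propositional using (_∈_; _∉_)
open import Data.List.Membership.Propositional.Properties using (∈-++⁺ʳ)
open import Data.List.Relation.Binary.Subset.Propositional using (_⊆_)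
open import Data.List.Relation.Binary.Subset.Propositional.Properties using (⊆-reflexive; ∷⁺ʳ; ++⁺ʳ)
open import Data.List.Relation.Unary.Any using (here; there)
open import Data.List.Relation.Unary.Any.Properties using (reverse⁻)
open import Data.List.Relation.Unary.All using (lookup; _∷_)
open import Data.List.Relation.Unary.AllPairs using (_∷_)
open import Data.List.Relation.Unary.Unique.Propositional using (Unique)
open import Data.Fin using (Fin)
open import Data.Product using (Σ; _×_; _,_; proj₁; proj₂)
open import Data.Sum using (_⊎_; inj₁; inj₂)
open import Data.Empty using (⊥-elim)
open import Relation.Nullary using (¬_)
open import Relation.Binary.PropositionalEquality using (_≡_; _≢_; refl; sym; cong; subst; module ≡-Reasoning)
open import Function using (_∘_)

module _ {A : Set} where

  private variable
    x y z u v w : A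
    xs ys bs : List A

  data Adjacent : List A → A → A → Set where
    here  : Adjacent (x ∷ y ∷ xs) x y
    there : Adjacent xs x y → Adjacent (z ∷ xs) x y

  Edge : List A → A → A → Set
  Edge xs x y = Adjacent xs x y ⊎ Adjacent xs y x

  Edge-sym : Edge xs x y → Edge xs y x
  Edge-sym (inj₁ p) = inj₂ p
  Edge-sym (inj₂ p) = inj₁ p

  Edge-transfer : {P : A → Set} →
                  (∀ {x y} → Adjacent xs x y → P x → P y → Edge ys x y) →
                  Edge xs x y → P x → P y → Edge ys x y
  Edge-transfer f (inj₁ p) px py = f p px py
  Edge-transfer f (inj₂ p) px py = Edge-sym (f p py px)

  Consec⇒Adjacent : Consec xs x y → Adjacent xs x y
  Consec⇒Adjacent ([]     , _ , refl) = here
  Consec⇒Adjacent (_ ∷ as , _ , refl) = there (Consec⇒Adjacent (as , _ , refl))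

  Adjacent⇒Consec : Adjacent xs x y → Consec xs x y
  Adjacent⇒Consec here = [] , _ , refl
  Adjacent⇒Consec (there {z = z} p) with Adjacent⇒Consec p
  ... | as , bs , refl = z ∷ as , bs , refl

  EdgeOf⇒Edge : EdgeOf xs x y → Edge xs x y
  EdgeOf⇒Edge (inj₁ c) = inj₁ (Consec⇒Adjacent c)
  EdgeOf⇒Edge (inj₂ c) = inj₂ (Consec⇒Adjacent c)

  Edge⇒EdgeOf : Edge xs x y → EdgeOf xs x y
  Edge⇒EdgeOf (inj₁ p) = inj₁ (Adjacent⇒Consec p)
  Edge⇒EdgeOf (inj₂ p) = inj₂ (Adjacent⇒Consec p)

  Adjacent-target-∈ : Adjacent (z ∷ xs) x y → y ∈ xs
  Adjacent-target-∈ here                = here refl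
  Adjacent-target-∈ (there p@here)      = there (Adjacent-target-∈ p)
  Adjacent-target-∈ (there p@(there _)) = there (Adjacent-target-∈ p)

  Adjacent-∷⁻ : Adjacent (z ∷ xs) x y → x ≡ z ⊎ Adjacent xs x y
  Adjacent-∷⁻ here      = inj₁ refl
  Adjacent-∷⁻ (there p) = inj₂ p

  Adjacent-++⁺ˡ : ∀ ys → Adjacent xs x y → Adjacent (xs ++ ys) x y
  Adjacent-++⁺ˡ ys here      = here
  Adjacent-++⁺ˡ ys (there p) = there (Adjacent-++⁺ˡ ys p)

  Adjacent-++⁺ʳ : ∀ xs → Adjacent ys x y → Adjacent (xs ++ ys) x y
  Adjacent-++⁺ʳ []       p = p
  Adjacent-++⁺ʳ (_ ∷ xs) p = there (Adjacent-++⁺ʳ xs p)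

  Adjacent-∷ʳ-++⁺ : ∀ xs → Adjacent (xs ++ [ z ]) x y → Adjacent (xs ++ z ∷ ys) x y
  Adjacent-∷ʳ-++⁺ []           (there ())
  Adjacent-∷ʳ-++⁺ (_ ∷ [])     here      = here
  Adjacent-∷ʳ-++⁺ (_ ∷ _ ∷ _)  here      = here
  Adjacent-∷ʳ-++⁺ (_ ∷ xs)     (there p) = there (Adjacent-∷ʳ-++⁺ xs p)

  Adjacent-++⁻ : ∀ xs → Adjacent (xs ++ z ∷ ys) x y → Adjacent (xs ++ [ z ]) x y ⊎ Adjacent (z ∷ ys) x y
  Adjacent-++⁻ []           p         = inj₂ p
  Adjacent-++⁻ (_ ∷ [])     here      = inj₁ here
  Adjacent-++⁻ (_ ∷ _ ∷ _)  here      = inj₁ here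
  Adjacent-++⁻ (_ ∷ xs)     (there p) with Adjacent-++⁻ xs p
  ... | inj₁ q = inj₁ (there q)
  ... | inj₂ q = inj₂ q

  Adjacent-∷ʳ⁻ : ∀ xs → Adjacent (xs ++ [ z ]) x y → Adjacent xs x y ⊎ (y ≡ z × Σ (List A) λ ys → xs ≡ ys ++ [ x ])
  Adjacent-∷ʳ⁻ []           (there ())
  Adjacent-∷ʳ⁻ (_ ∷ [])     here      = inj₂ (refl , [] , refl)
  Adjacent-∷ʳ⁻ (_ ∷ _ ∷ _)  here      = inj₁ here
  Adjacent-∷ʳ⁻ (a ∷ xs)     (there p) with Adjacent-∷ʳ⁻ xs p
  ... | inj₁ q                 = inj₁ (there q)
  ... | inj₂ (refl , ys , refl) = inj₂ (refl , a ∷ ys , refl)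

  Adjacent-reverse : Adjacent xs x y → Adjacent (reverse xs) y x
  Adjacent-reverse {x ∷ y ∷ xs} here
    rewrite unfold-reverse x (y ∷ xs) | unfold-reverse y xs | ++-assoc (reverse xs) [ y ] [ x ]
    = Adjacent-++⁺ʳ (reverse xs) here
  Adjacent-reverse {z ∷ xs} (there p)
    rewrite unfold-reverse z xs
    = Adjacent-++⁺ˡ [ z ] (Adjacent-reverse p)

  Adjacent-reverse-∷ʳ : ∀ bs → Adjacent (bs ++ [ u ]) x y → Adjacent (u ∷ reverse bs) y x
  Adjacent-reverse-∷ʳ {u = u} bs p = subst (λ l → Adjacent l _ _) (reverse-++ bs [ u ]) (Adjacent-reverse p)

  Edge-reroute : ∀ as bs → Adjacent (as ++ v ∷ w ∷ bs ++ [ u ]) x y → x ≢ w → y ≢ w →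
                 Edge (as ++ v ∷ u ∷ reverse bs ++ [ w ]) x y
  Edge-reroute as bs p x≢w y≢w with Adjacent-++⁻ as p
  ... | inj₁ q         = inj₁ (Adjacent-∷ʳ-++⁺ as q)
  ... | inj₂ here      = ⊥-elim (y≢w refl)
  ... | inj₂ (there q) with Adjacent-∷⁻ q
  ...   | inj₁ x≡w = ⊥-elim (x≢w x≡w)
  ...   | inj₂ q′  = inj₂ (Adjacent-++⁺ʳ as (there (Adjacent-++⁺ˡ _ (Adjacent-reverse-∷ʳ bs q′))))

  ∷ʳ-last-∈ : ∀ ys → z ∷ y ∷ xs ≡ ys ++ [ x ] → x ∈ y ∷ xs
  ∷ʳ-last-∈ (_ ∷ ys) eq = subst (_ ∈_) (sym (∷-injectiveʳ eq)) (∈-++⁺ʳ ys (here refl))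

  reroute-⊆ : ∀ bs → u ∷ reverse bs ++ [ w ] ⊆ w ∷ bs ++ [ u ]
  reroute-⊆ {u = u} {w = w} bs = reverse⁻ ∘ ⊆-reflexive reversed
    where
    open ≡-Reasoning
    reversed : u ∷ reverse bs ++ [ w ] ≡ reverse (w ∷ bs ++ [ u ])
    reversed = sym (begin
      reverse (w ∷ bs ++ [ u ])     ≡⟨ unfold-reverse w (bs ++ [ u ]) ⟩
      reverse (bs ++ [ u ]) ++ [ w ] ≡⟨ cong (_++ [ w ]) (reverse-++ bs [ u ]) ⟩
      u ∷ reverse bs ++ [ w ]       ∎)

module _ (G : Graph) where
  open Graph G using (n; E)

  private variable
    c₁ x y : Fin n
    cs ys Q : List (Fin n)
    i : ℕ

  Rooted : Fin n → List (Fin n) → Set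
  Rooted c₁ Q = Σ (List (Fin n)) λ tl → Q ≡ c₁ ∷ tl × c₁ ∉ tl

  active-path-rooted : Unique (c₁ ∷ cs) → S G c₁ cs i Q → Rooted c₁ Q
  active-path-rooted (c₁∉cs ∷ _) base₁ = _ , refl , λ m → lookup c₁∉cs m refl
  active-path-rooted (c₁∉cs ∷ _) base₂ = _ , refl , λ m → lookup c₁∉cs (reverse⁻ m) refl
  active-path-rooted uniq (step [] bs _ _ _ s _ _) with active-path-rooted uniq s
  ... | _ , refl , c₁∉tl = _ , refl , c₁∉tl ∘ reroute-⊆ bs
  active-path-rooted uniq (step (_ ∷ as) bs v _ _ s _ _) with active-path-rooted uniq s
  ... | _ , refl , c₁∉tl = _ , refl , c₁∉tl ∘ ++⁺ʳ as (∷⁺ʳ v (reroute-⊆ bs))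

  active-path-adjacent-target-≢ : Unique (c₁ ∷ cs) → S G c₁ cs i Q → Adjacent Q x y → y ≢ c₁
  active-path-adjacent-target-≢ uniq s p y≡c₁ with active-path-rooted uniq s
  ... | tl , refl , c₁∉tl = c₁∉tl (subst (_∈ tl) y≡c₁ (Adjacent-target-∈ p))

  rerouted-end-active : ∀ as bs v w u → Unique (c₁ ∷ cs) →
                        S G c₁ cs i (as ++ v ∷ w ∷ bs ++ [ u ]) → E u v → CycleEdge G c₁ cs v w →
                        ActiveVertex G c₁ cs w
  rerouted-end-active {i = i} as bs v w u uniq s uv vw =
    active-path-adjacent-target-≢ uniq s (Adjacent-++⁺ʳ as here) ,
    _ , (suc i , step as bs v w u s uv vw) , as ++ v ∷ u ∷ reverse bs ,
    sym (++-assoc as _ [ w ])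

  closing-vertex-active : IsCycle G c₁ cs → c₁ ∷ cs ≡ ys ++ [ x ] → ActiveVertex G c₁ cs x
  closing-vertex-active {cs = []} (() , _) _
  closing-vertex-active {cs = _ ∷ _} {ys} (_ , c₁∉cs ∷ _ , _) eq =
    (λ x≡c₁ → lookup c₁∉cs (∷ʳ-last-∈ ys eq) (sym x≡c₁)) , _ , (0 , base₁) , ys , eq

  forward-path-edge : IsCycle G c₁ cs → Adjacent (c₁ ∷ cs ++ [ c₁ ]) x y →
                      ¬ ActiveVertex G c₁ cs x → Edge (c₁ ∷ cs) x y
  forward-path-edge {c₁} {cs} cyc p x-passive with Adjacent-∷ʳ⁻ (c₁ ∷ cs) p
  ... | inj₁ q            = inj₁ q
  ... | inj₂ (_ , _ , eq) = ⊥-elim (x-passive (closing-vertex-active cyc eq))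

  backward-path-edge : IsCycle G c₁ cs → Adjacent (c₁ ∷ cs ++ [ c₁ ]) x y →
                       ¬ ActiveVertex G c₁ cs y → Edge (c₁ ∷ reverse cs) x y
  backward-path-edge {cs = []} (() , _) _ _
  backward-path-edge {c₁} {c₂ ∷ cs} (_ , (c₁≢c₂ ∷ _) ∷ _ , _) here y-passive =
    ⊥-elim (y-passive (c₁≢c₂ ∘ sym , _ , (0 , base₂) , c₁ ∷ reverse cs , cong (c₁ ∷_) (unfold-reverse c₂ cs)))
  backward-path-edge {cs = cs} _ (there p) _ = inj₂ (Adjacent-reverse-∷ʳ cs p)

  passive-edge-on-active-path : IsCycle G c₁ cs → S G c₁ cs i Q → Edge (c₁ ∷ cs ++ [ c₁ ]) x y →
                                ¬ ActiveVertex G c₁ cs x → ¬ ActiveVertex G c₁ cs y → Edge Q x y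
  passive-edge-on-active-path cyc base₁ = Edge-transfer (λ p x-passive _ → forward-path-edge cyc p x-passive)
  passive-edge-on-active-path cyc base₂ = Edge-transfer (λ p _ y-passive → backward-path-edge cyc p y-passive)
  passive-edge-on-active-path {c₁} {cs} cyc (step as bs v w u s uv vw) e x-passive y-passive =
    Edge-transfer (Edge-reroute as bs) (passive-edge-on-active-path cyc s e x-passive y-passive)
                  (avoids-w x-passive) (avoids-w y-passive)
    where
    avoids-w : ∀ {z} → ¬ ActiveVertex G c₁ cs z → z ≢ w
    avoids-w z-passive refl = z-passive (rerouted-end-active as bs v w u (proj₁ (proj₂ cyc)) s uv vw)

lemma6 : (G : Graph) (k : ℕ) → 2 ≤ k → MinDegAtLeast G k →
         (L : Lollipop G) → Optimal G L →
         ∀ (Q : List (Fin (Graph.n G))) → ActivePath G (Lollipop.c1 L) (Lollipop.cs L) Q →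
         ∀ (x y : Fin (Graph.n G)) → PassiveEdge G (Lollipop.c1 L) (Lollipop.cs L) x y →
         EdgeOf Q x y
lemma6 G _ _ _ L _ Q (_ , s) x y (e , x-passive , y-passive) =
  Edge⇒EdgeOf (passive-edge-on-active-path G (Lollipop.cyc L) s (EdgeOf⇒Edge e) x-passive y-passive)
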